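{- For each integer $n\ge13$ with $n\ne16$, \begin{align*} \mu_5^{\mathrm P_3}(G_n)-\mu_5^{\mathrm P_3}(H_n)&=(\ell_1+1-\ell_5)(\ell_2\ell_4\ell_6+\ell_6\ell_{10}\ell_{12}+\ell_7\ell_{10}\ell_{11})\\ &\quad+\ell_2\ell_3\ell_4\ell_{10}+\ell_3\ell_6\ell_7\ell_{11}+\ell_2\ell_6\ell_7\ell_9+\ell_4\ell_7\ell_8\ell_9\\ &\quad+\ell_3\ell_6\ell_8\ell_{10}+\ell_2\ell_9\ell_{11}\ell_{12}+\ell_4\ell_9\ell_{10}\ell_{11}\\ &\quad-\ell_2\ell_3\ell_7\ell_8-\ell_2\ell_4\ell_9\ell_{12}-\ell_3\ell_4\ell_6\ell_7-\ell_2\ell_3\ell_{10}\ell_{11}\\ &\quad-\ell_3\ell_4\ell_{11}\ell_{12}-\ell_6\ell_8\ell_9\ell_{12}-\ell_7\ell_8\ell_9\ell_{11}. \end{align*}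
   Context: $W$ (Wagner graph) has vertices $1,\dots,8$ and edges $e_1=15$, $e_2=37$, $e_3=26$, $e_4=48$, $e_5=12$, $e_6=67$, $e_7=34$, $e_8=81$, $e_9=56$, $e_{10}=45$, $e_{11}=78$, $e_{12}=23$. For positive integers $x_1,\dots,x_{12}$, $W(x_1,\dots,x_{12})$ is obtained from $W$ by replacing each $e_i$ with a path of $x_i$ edges (new internal vertices of degree 2); these paths are its chains, and edge $e_i$ of $W$ corresponds to the $i$-th chain. For $n\ge13$, $n\ne16$, let $r,s$ be the unique integers with $n+4=12s+r$, $r\in\{0,\dots,11\}$; $X_0=\emptyset$, $X_8=\{e_1,e_2,e_3,e_4,e_6,e_8,e_{10},e_{12}\}$, $X_r=\{e_1,\dots,e_r\}$ otherwise; $\ell_i=s+1$ if $e_i\in X_r$, else $\ell_i=s$; $G_n=W(\ell_1,\dots,\ell_{12})$ and $H_n=W(\ell_1',\dots,\ell_{12}')$ with $\ell_1'=\ell_1+1$, $\ell_5'=\ell_5-1$, $\ell_i'=\ell_i$ otherwise. A $k$-edge-cut is a set of $k$ edges whose removal disconnects the graph. An edge-cut $F$ of $W$ separates a vertex set $S$ if $F$ contains every edge with exactly one endpoint in $S$ and no edge with both endpoints in $S$; it is $P_3$-separating if it separates a set $S$ inducing in $W$ a path on three vertices. For $G\in\{G_n,H_n\}$, a $5$-edge-cut $\{a_1,\dots,a_5\}$ of $G$ is induced by a $5$-edge-cut $\{f_1,\dots,f_5\}$ of $W$ if each $a_j$ lies in the chain corresponding to $f_j$; $\mu_5^{\mathrm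 P_3}(G)$ is the number of $5$-edge-cuts of $G$ induced by $P_3$-separating $5$-edge-cuts of $W$. -}

module Defs where

open import Data.Nat using (ℕ; zero; suc; _+_; _*_; _∸_; _<_; _≤_; _<ᵇ_; _≡ᵇ_)
open import Data.Nat.DivMod using (_/_; _%_)
open import Data.Bool using (Bool; true; false; if_then_else_; _∨_)
open import Data.Fin using (Fin; toℕ; #_)
import Data.Fin as F
open import Data.Vec using (Vec; []; _∷_; lookup)
open import Data.List using (List; []; _∷_; length; map)
open import Data.List.Membership.Propositional using (_∈_; _∉_)
open import Data.List.Relation.Unary.All using (All)
open import Data.List.Relation.Unary.Unique.Propositional using (Unique)
open import Data.List.Relation.Unary.Linked using (Linked)
open import Data.List.Relation.Binary.Permutation.Propositional using (_↭_)
open import Data.Product using (Σ; _×_; _,_; proj₁; proj₂; Σ-syntax)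
open import Data.Sum using (_⊎_)
open import Data.Unit using (⊤)
open import Relation.Nullary using (¬_)
open import Relation.Binary.PropositionalEquality using (_≡_; _≢_)
open import Relation.Binary.Construct.Closure.ReflexiveTransitive using (Star)

-- The Wagner graph W.  Vertex j ∈ {1,…,8} is  # (j-1) : Fin 8,
-- edge e_i (i ∈ {1,…,12}) is  # (i-1) : Fin 12.

ends : Fin 12 → Fin 8 × Fin 8
ends i = lookup
  ( (# 0 , # 4) ∷ (# 2 , # 6) ∷ (# 1 , # 5) ∷ (# 3 , # 7)
  ∷ (# 0 , # 1) ∷ (# 5 , # 6) ∷ (# 2 , # 3) ∷ (# 7 , # 0)
  ∷ (# 4 , # 5) ∷ (# 3 , # 4) ∷ (# 6 , # 7) ∷ (# 1 , # 2) ∷ []) i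

src tgt : Fin 12 → Fin 8
src i = proj₁ (ends i)
tgt i = proj₂ (ends i)

WAdj : List (Fin 12) → Fin 8 → Fin 8 → Set
WAdj Fs u v = Σ[ e ∈ Fin 12 ] (e ∉ Fs ×
  ((src e ≡ u × tgt e ≡ v) ⊎ (src e ≡ v × tgt e ≡ u)))

WDisconnects : List (Fin 12) → Set
WDisconnects Fs = Σ[ u ∈ Fin 8 ] Σ[ v ∈ Fin 8 ] ¬ Star (WAdj Fs) u v

-- A set of edges of W is represented canonically as a strictly
-- increasing list.  A k-edge-cut of W:
WEdgeCut : ℕ → List (Fin 12) → Set
WEdgeCut k Fs = Linked F._<_ Fs × length Fs ≡ k × WDisconnects Fs

WAdjacent : Fin 8 → Fin 8 → Set
WAdjacent = WAdj []

InducesP3 : Fin 8 → Fin 8 → Fin 8 → Set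
InducesP3 a b c = a ≢ b × b ≢ c × a ≢ c ×
  WAdjacent a b × WAdjacent b c × ¬ WAdjacent a c

InS : Fin 8 → Fin 8 → Fin 8 → Fin 8 → Set
InS a b c v = v ≡ a ⊎ v ≡ b ⊎ v ≡ c

Separates : List (Fin 12) → Fin 8 → Fin 8 → Fin 8 → Set
Separates Fs a b c = (e : Fin 12) →
  ( ((InS a b c (src e) × ¬ InS a b c (tgt e)) ⊎
     (¬ InS a b c (src e) × InS a b c (tgt e)) → e ∈ Fs)
  × (InS a b c (src e) × InS a b c (tgt e) → e ∉ Fs))

P3Separating : List (Fin 12) → Set
P3Separating Fs = Σ[ a ∈ Fin 8 ] Σ[ b ∈ Fin 8 ] Σ[ c ∈ Fin 8 ]
  (InducesP3 a b c × Separates Fs a b c)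

-- Vertices: original vertices (inj₁ v) and
-- internal vertices (inj₂ (i , p)), 1 ≤ p < x i, the p-th internal
-- vertex of chain i.  Edges: (i , k) with k < x i, the k-th edge of
-- chain i, joining the chain positions k and k+1, where position 0 is
-- the first listed endpoint of e_i and position x i the second.

GV : Set
GV = Fin 8 ⊎ (Fin 12 × ℕ)

GE : Set
GE = Fin 12 × ℕ

ValidV : (Fin 12 → ℕ) → GV → Set
ValidV x (Data.Sum.inj₁ _) = ⊤
ValidV x (Data.Sum.inj₂ (i , p)) = 1 ≤ p × p < x i

ValidE : (Fin 12 → ℕ) → GE → Set
ValidE x (i , k) = k < x i

pos : (Fin 12 → ℕ) → Fin 12 → ℕ → GV
pos x i p = if p ≡ᵇ 0 then Data.Sum.inj₁ (src i)
            else if p ≡ᵇ x i then Data.Sum.inj₁ (tgt i)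
            else Data.Sum.inj₂ (i , p)

GAdj : (Fin 12 → ℕ) → List GE → GV → GV → Set
GAdj x A u v = Σ[ e ∈ GE ] (ValidE x e × e ∉ A ×
  ((pos x (proj₁ e) (proj₂ e) ≡ u × pos x (proj₁ e) (suc (proj₂ e)) ≡ v) ⊎
   (pos x (proj₁ e) (proj₂ e) ≡ v × pos x (proj₁ e) (suc (proj₂ e)) ≡ u)))

GDisconnects : (Fin 12 → ℕ) → List GE → Set
GDisconnects x A = Σ[ u ∈ GV ] Σ[ v ∈ GV ]
  (ValidV x u × ValidV x v × ¬ Star (GAdj x A) u v)

_<ᴱ_ : GE → GE → Set
(i , k) <ᴱ (j , m) = (toℕ i < toℕ j) ⊎ (i ≡ j × k < m)

GEdgeCut : (Fin 12 → ℕ) → ℕ → List GE → Set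
GEdgeCut x k A = Linked _<ᴱ_ A × All (ValidE x) A × length A ≡ k × GDisconnects x A

-- a 5-edge-cut of W(x) induced by a P3-separating 5-edge-cut of W:
-- the chains containing a_1,…,a_5 are f_1,…,f_5 (matched bijectively)
InducedP3Cut : (Fin 12 → ℕ) → List GE → Set
InducedP3Cut x A = GEdgeCut x 5 A × Σ[ Fs ∈ List (Fin 12) ]
  (WEdgeCut 5 Fs × P3Separating Fs × map proj₁ A ↭ Fs)

CountIs : {A : Set} → (A → Set) → ℕ → Set
CountIs {A} P m = Σ[ L ∈ List A ]
  (Unique L × ((a : A) → (a ∈ L → P a) × (P a → a ∈ L)) × length L ≡ m)

μ5P3 : (Fin 12 → ℕ) → ℕ → Set
μ5P3 x m = CountIs (InducedP3Cut x) m

sOf rOf : ℕ → ℕ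
sOf n = (n + 4) / 12
rOf n = (n + 4) % 12

-- membership of e_k (1-based k) in X_r
inX : ℕ → ℕ → Bool
inX r k = if r ≡ᵇ 0 then false
          else if r ≡ᵇ 8 then
            ((k ≡ᵇ 1) ∨ (k ≡ᵇ 2) ∨ (k ≡ᵇ 3) ∨ (k ≡ᵇ 4) ∨
             (k ≡ᵇ 6) ∨ (k ≡ᵇ 8) ∨ (k ≡ᵇ 10) ∨ (k ≡ᵇ 12))
          else (k <ᵇ suc r)

ℓ : ℕ → ℕ → ℕ
ℓ n k = if inX (rOf n) k then suc (sOf n) else sOf n

ℓ' : ℕ → ℕ → ℕ
ℓ' n k = if k ≡ᵇ 1 then suc (ℓ n k)
         else if k ≡ᵇ 5 then ℓ n k ∸ 1
         else ℓ n k

-- chain lengths of G_n and H_n (chain of e_{i+1} is index i : Fin 12)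
lenG lenH : ℕ → Fin 12 → ℕ
lenG n i = ℓ n (suc (toℕ i))
lenH n i = ℓ' n (suc (toℕ i))

{-# OPTIONS --safe #-}
module Submission where

-- A P₃-separating 5-edge-cut of W contains the boundary of its path S = {a, b, c}, which
-- already has 3·3 − 2·2 = 5 edges, so the cut is that boundary.  Choosing one edge in each
-- of the five corresponding chains of W(x) again cuts W(x): colour the vertices by their
-- side of S, switching along each chain at its removed edge.  So μ₅^{P₃}(W(x)) is the sum
-- of Π_{f ∈ F} x_f over the distinct boundaries F of induced P₃'s, and as H_n is G_n with one
-- unit moved from chain 5 to chain 1, the theorem becomes a polynomial identity in ℓ₁, …, ℓ₁₂.

open import Level using (0ℓ)
open import Algebra.Bundles.Raw using (RawSemiring; RawRing)
open import Data.Bool using (Bool; true; false; if_then_else_; _∨_; T)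
import Data.Bool.Properties as Boolₚ
open import Data.Fin as Fin using (Fin; zero; suc; #_; toℕ)
import Data.Fin.Properties as Finₚ
open import Data.List
  using (List; []; _∷_; [_]; _++_; length; map; foldr; filter; concatMap; upTo; allFin;
         cartesianProduct; cartesianProductWith; deduplicate)
import Data.List.Properties as Listₚ
open import Data.List.Membership.Propositional using (_∈_; _∉_; find; lose)
open import Data.List.Membership.Propositional.Properties
  using (∈-map⁺; ∈-map⁻; ∈-filter⁺; ∈-filter⁻; ∈-allFin; ∈-cartesianProduct⁺;
         ∈-cartesianProductWith⁺; ∈-cartesianProductWith⁻; ∈-upTo⁺; ∈-upTo⁻;
         ∈-concatMap⁺; ∈-concatMap⁻; ∈-deduplicate⁺; ∈-deduplicate⁻)
open import Data.List.Membership.Propositional.Properties.WithK using (unique∧set⇒bag)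
open import Data.List.Relation.Binary.BagAndSetEquality using (∼bag⇒↭)
open import Data.List.Relation.Binary.Permutation.Propositional using (_↭_; ↭-reflexive; ↭⇒↭ₛ)
open import Data.List.Relation.Binary.Permutation.Propositional.Properties using (↭-length)
open import Data.List.Relation.Binary.Pointwise using (Pointwise-≡⇒≡)
open import Data.List.Relation.Binary.Sublist.Heterogeneous using (Sublist; _∷_; _∷ʳ_; minimum)
open import Data.List.Relation.Binary.Sublist.Heterogeneous.Properties using (toPointwise)
open import Data.List.Relation.Binary.Subset.Propositional using (_⊆_)
open import Data.List.Relation.Unary.All as All using (All; []; _∷_)
open import Data.List.Relation.Unary.AllPairs using ([]; _∷_)
open import Data.List.Relation.Unary.Any using (here; there; any?)
open import Data.List.Relation.Unary.Linked as Linked using (Linked; linked?)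
import Data.List.Relation.Unary.Linked.Properties as Linkedₚ
open import Data.List.Relation.Unary.Sorted.TotalOrder.Properties using (↗↭↗⇒≋)
open import Data.List.Relation.Unary.Unique.Propositional using (Unique)
import Data.List.Relation.Unary.Unique.Propositional.Properties as Uniqueₚ
open import Data.List.Relation.Unary.Unique.DecPropositional.Properties using (deduplicate-!)
open import Data.Nat as ℕ using (ℕ; zero; suc; _≤_; _∸_)
import Data.Nat.Properties as ℕₚ
open import Data.Nat.DivMod using (_mod_; m≥n⇒m/n>0)
open import Data.Product using (Σ-syntax; _×_; _,_; proj₁; proj₂)
import Data.Product.Properties as Productₚ
open import Data.Sum using (_⊎_; inj₁; inj₂)
open import Data.Unit using (tt)
open import Data.Vec using (tabulate)
open import Function using (_∘_; mk⇔)
open import Relation.Binary using (Rel; Transitive; Trichotomous; tri<; tri≈; tri>)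
open import Relation.Binary.Consequences using (tri⇒irr)
open import Relation.Binary.Construct.Closure.ReflexiveTransitive using (Star; fold)
open import Relation.Binary.PropositionalEquality
  using (_≡_; _≢_; _≗_; refl; sym; trans; cong; cong₂; subst; module ≡-Reasoning)
open import Relation.Nullary using (¬_; Dec; yes; no; does; ¬?; contradiction)
open import Relation.Nullary.Decidable
  using (_×-dec_; _⊎-dec_; toWitness; dec-true; dec-false)
open import Defs

CountIs-unique : ∀ {A : Set} {P : A → Set} {m n} → CountIs P m → CountIs P n → m ≡ n
CountIs-unique (L , L! , L⇔P , refl) (K , K! , K⇔P , refl) =
  ↭-length (∼bag⇒↭ (unique∧set⇒bag L! K! (mk⇔ (L⊆K _) (K⊆L _))))
  where
  L⊆K : ∀ a → a ∈ L → a ∈ K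
  L⊆K a = proj₂ (K⇔P a) ∘ proj₁ (L⇔P a)
  K⊆L : ∀ a → a ∈ K → a ∈ L
  K⊆L a = proj₂ (L⇔P a) ∘ proj₁ (K⇔P a)

length-cartesianProductWith : ∀ {A B C : Set} (f : A → B → C) xs ys →
  length (cartesianProductWith f xs ys) ≡ length xs ℕ.* length ys
length-cartesianProductWith f []       ys = refl
length-cartesianProductWith f (x ∷ xs) ys = begin
  length (map (f x) ys ++ cartesianProductWith f xs ys)
    ≡⟨ Listₚ.length-++ (map (f x) ys) ⟩
  length (map (f x) ys) ℕ.+ length (cartesianProductWith f xs ys)
    ≡⟨ cong₂ ℕ._+_ (Listₚ.length-map (f x) ys) (length-cartesianProductWith f xs ys) ⟩
  length ys ℕ.+ length xs ℕ.* length ys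
    ∎
  where open ≡-Reasoning

Star-invariant : ∀ {V C : Set} {E : Rel V 0ℓ} (χ : V → C) →
  (∀ {u v} → E u v → χ u ≡ χ v) → ∀ {u v} → Star E u v → χ u ≡ χ v
Star-invariant χ χ-resp = fold (λ u v → χ u ≡ χ v) (λ e eq → trans (χ-resp e) eq) refl

does-≡ : ∀ {P Q : Set} (P? : Dec P) (Q? : Dec Q) →
         ¬ (P × ¬ Q) → ¬ (¬ P × Q) → does P? ≡ does Q?
does-≡ (yes _) (yes _) _    _    = refl
does-≡ (no _)  (no _)  _    _    = refl
does-≡ (yes p) (no ¬q) p¬q  _    = contradiction (p , ¬q) p¬q
does-≡ (no ¬p) (yes q) _    ¬pq  = contradiction (¬p , q) ¬pq

module _ {A : Set} {_<_ : Rel A 0ℓ} (<-trans : Transitive _<_) (<-cmp : Trichotomous _≡_ _<_) where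

  private
    below : ∀ {x xs z} → Linked _<_ (x ∷ xs) → z ∈ xs → x < z
    below l z∈xs with Linkedₚ.Linked⇒AllPairs <-trans l
    ... | x<xs ∷ _ = All.lookup x<xs z∈xs

    ∈-tail : ∀ {y ys z} → y < z → z ∈ y ∷ ys → z ∈ ys
    ∈-tail y<y (here refl)  = contradiction y<y (tri⇒irr <-cmp refl)
    ∈-tail _   (there z∈ys) = z∈ys

  Linked-⊆⇒Sublist : ∀ {xs ys} → Linked _<_ xs → Linked _<_ ys → xs ⊆ ys → Sublist _≡_ xs ys
  Linked-⊆⇒Sublist {[]}     _ _ _ = minimum _
  Linked-⊆⇒Sublist {x ∷ xs} {[]} _ _ xs⊆ys with xs⊆ys (here refl)
  ... | ()
  Linked-⊆⇒Sublist {x ∷ xs} {y ∷ ys} lx ly xs⊆ys with <-cmp x y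
  ... | tri< _ x≢y y≮x with xs⊆ys (here refl)
  ...   | here x≡y   = contradiction x≡y x≢y
  ...   | there x∈ys = contradiction (below ly x∈ys) y≮x
  Linked-⊆⇒Sublist {x ∷ xs} {y ∷ ys} lx ly xs⊆ys | tri≈ _ refl _ =
    refl ∷ Linked-⊆⇒Sublist (Linked.tail lx) (Linked.tail ly)
                            (λ z∈xs → ∈-tail (below lx z∈xs) (xs⊆ys (there z∈xs)))
  Linked-⊆⇒Sublist {x ∷ xs} {y ∷ ys} lx ly xs⊆ys | tri> _ _ y<x =
    y ∷ʳ Linked-⊆⇒Sublist lx (Linked.tail ly) (λ z∈ → ∈-tail (y<· z∈) (xs⊆ys z∈))
    where
    y<· : ∀ {z} → z ∈ x ∷ xs → y < z
    y<· (here refl)  = y<x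
    y<· (there z∈xs) = <-trans y<x (below lx z∈xs)

  Linked-⊆-length⇒≡ : ∀ {xs ys} → Linked _<_ xs → Linked _<_ ys → xs ⊆ ys →
                      length xs ≡ length ys → xs ≡ ys
  Linked-⊆-length⇒≡ lx ly xs⊆ys |xs|≡|ys| =
    Pointwise-≡⇒≡ (toPointwise |xs|≡|ys| (Linked-⊆⇒Sublist lx ly xs⊆ys))

module _ {I : Set} (R : RawSemiring 0ℓ 0ℓ) where
  open RawSemiring R

  productOf : (I → Carrier) → List I → Carrier
  productOf x = foldr (λ i p → x i * p) 1#

  sumOfProducts : (I → Carrier) → List (List I) → Carrier
  sumOfProducts x = foldr (λ B s → productOf x B + s) 0#

  sumOfProducts-cong : ∀ {x y} → x ≗ y → ∀ Bs → sumOfProducts x Bs ≡ sumOfProducts y Bs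
  sumOfProducts-cong {x} {y} x≗y = Listₚ.foldr-cong (λ B s → cong (_+ s) (productOf-cong B)) refl
    where
    productOf-cong : ∀ B → productOf x B ≡ productOf y B
    productOf-cong = Listₚ.foldr-cong (λ i p → cong (_* p) (x≗y i)) refl

InS? : ∀ a b c v → Dec (InS a b c v)
InS? a b c v = v Finₚ.≟ a ⊎-dec v Finₚ.≟ b ⊎-dec v Finₚ.≟ c

inS : Fin 8 → Fin 8 → Fin 8 → Fin 8 → Bool
inS a b c v = does (InS? a b c v)

WAdj? : ∀ Fs u v → Dec (WAdj Fs u v)
WAdj? Fs u v = Finₚ.any? λ e → ¬? (any? (e Finₚ.≟_) Fs) ×-dec
  (src e Finₚ.≟ u ×-dec tgt e Finₚ.≟ v ⊎-dec src e Finₚ.≟ v ×-dec tgt e Finₚ.≟ u)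

InducesP3? : ∀ a b c → Dec (InducesP3 a b c)
InducesP3? a b c = ¬? (a Finₚ.≟ b) ×-dec ¬? (b Finₚ.≟ c) ×-dec ¬? (a Finₚ.≟ c) ×-dec
  WAdj? [] a b ×-dec WAdj? [] b c ×-dec ¬? (WAdj? [] a c)

Boundary : Fin 8 → Fin 8 → Fin 8 → Fin 12 → Set
Boundary a b c e =
  (InS a b c (src e) × ¬ InS a b c (tgt e)) ⊎ (¬ InS a b c (src e) × InS a b c (tgt e))

Boundary? : ∀ a b c e → Dec (Boundary a b c e)
Boundary? a b c e = InS? a b c (src e) ×-dec ¬? (InS? a b c (tgt e))
               ⊎-dec ¬? (InS? a b c (src e)) ×-dec InS? a b c (tgt e)

boundary : Fin 8 → Fin 8 → Fin 8 → List (Fin 12)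
boundary a b c = filter (Boundary? a b c) (allFin 12)

Triple : Set
Triple = Fin 8 × Fin 8 × Fin 8

-- Named uncurried forms: two copies of a pattern lambda are not definitionally equal.
InducesP3ᵗ? : ∀ ((a , b , c) : Triple) → Dec (InducesP3 a b c)
InducesP3ᵗ? (a , b , c) = InducesP3? a b c

boundaryᵗ : Triple → List (Fin 12)
boundaryᵗ (a , b , c) = boundary a b c

triples : List Triple
triples = cartesianProduct (allFin 8) (cartesianProduct (allFin 8) (allFin 8))

p3Boundaries : List (List (Fin 12))
p3Boundaries = map boundaryᵗ (filter InducesP3ᵗ? triples)

p3Cuts : List (List (Fin 12))
p3Cuts = deduplicate (Listₚ.≡-dec Finₚ._≟_) p3Boundaries

∈-p3Cuts⁺ : ∀ {a b c} → InducesP3 a b c → boundary a b c ∈ p3Cuts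
∈-p3Cuts⁺ {a} {b} {c} p3 = ∈-deduplicate⁺ (Listₚ.≡-dec Finₚ._≟_) (∈-map⁺ boundaryᵗ
  (∈-filter⁺ InducesP3ᵗ?
    (∈-cartesianProduct⁺ (∈-allFin a) (∈-cartesianProduct⁺ (∈-allFin b) (∈-allFin c))) p3))

∈-p3Cuts⁻ : ∀ {B} → B ∈ p3Cuts →
            Σ[ (a , b , c) ∈ Triple ] (InducesP3 a b c × B ≡ boundary a b c)
∈-p3Cuts⁻ {B} B∈ =
  from-triple (∈-map⁻ boundaryᵗ {xs = filter InducesP3ᵗ? triples}
                (∈-deduplicate⁻ (Listₚ.≡-dec Finₚ._≟_) p3Boundaries B∈))
  where
  from-triple : Σ[ t ∈ Triple ] (t ∈ filter InducesP3ᵗ? triples × B ≡ boundaryᵗ t) →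
                Σ[ (a , b , c) ∈ Triple ] (InducesP3 a b c × B ≡ boundary a b c)
  from-triple (t , t∈ , refl) = t , proj₂ (∈-filter⁻ InducesP3ᵗ? {xs = triples} t∈) , refl

p3Cuts-unique : Unique p3Cuts
p3Cuts-unique = deduplicate-! (Listₚ.≡-dec Finₚ._≟_) p3Boundaries

p3Cuts-length : All (λ B → length B ≡ 5) p3Cuts
p3Cuts-length = toWitness {a? = All.all? (λ B → length B ℕ.≟ 5) p3Cuts} tt

p3-boundary-length : ∀ {a b c} → InducesP3 a b c → length (boundary a b c) ≡ 5
p3-boundary-length p3 = All.lookup p3Cuts-length (∈-p3Cuts⁺ p3)

boundary-sorted : ∀ a b c → Linked Fin._<_ (boundary a b c)
boundary-sorted a b c = Linkedₚ.filter⁺ (Boundary? a b c) Finₚ.<-trans allFin-sorted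
  where
  allFin-sorted : Linked Fin._<_ (allFin 12)
  allFin-sorted = toWitness {a? = linked? Fin._<?_ (allFin 12)} tt

boundary-separates : ∀ a b c → Separates (boundary a b c) a b c
boundary-separates a b c e = ∈-filter⁺ (Boundary? a b c) (∈-allFin e) , inner∉
  where
  inner∉ : InS a b c (src e) × InS a b c (tgt e) → e ∉ boundary a b c
  inner∉ (s , t) e∈ with proj₂ (∈-filter⁻ (Boundary? a b c) {xs = allFin 12} e∈)
  ... | inj₁ (_ , ¬t) = ¬t t
  ... | inj₂ (¬s , _) = ¬s s

boundary-⊆ : ∀ {Fs a b c} → Separates Fs a b c → boundary a b c ⊆ Fs
boundary-⊆ {a = a} {b} {c} sep {e} e∈ =
  proj₁ (sep e) (proj₂ (∈-filter⁻ (Boundary? a b c) {xs = allFin 12} e∈))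

inS-self : ∀ a b c → inS a b c a ≡ true
inS-self a b c = dec-true (InS? a b c a) (inj₁ refl)

outside : ∀ a b c → Σ[ w ∈ Fin 8 ] inS a b c w ≡ false
outside = toWitness {a? = Finₚ.all? λ a → Finₚ.all? λ b → Finₚ.all? λ c →
                           Finₚ.any? λ w → inS a b c w Boolₚ.≟ false} tt

separates-monochromatic : ∀ {Fs a b c} → Separates Fs a b c →
                          ∀ e → e ∉ Fs → inS a b c (src e) ≡ inS a b c (tgt e)
separates-monochromatic {a = a} {b} {c} sep e e∉Fs =
  does-≡ (InS? a b c (src e)) (InS? a b c (tgt e))
         (e∉Fs ∘ proj₁ (sep e) ∘ inj₁) (e∉Fs ∘ proj₁ (sep e) ∘ inj₂)

separates⇒disconnects : ∀ {Fs a b c} → Separates Fs a b c → WDisconnects Fs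
separates⇒disconnects {Fs} {a} {b} {c} sep = a , proj₁ (outside a b c) , λ path →
  contradiction (trans (sym (inS-self a b c))
                       (trans (Star-invariant (inS a b c) step path) (proj₂ (outside a b c))))
                λ ()
  where
  step : ∀ {u v} → WAdj Fs u v → inS a b c u ≡ inS a b c v
  step (e , e∉Fs , inj₁ (refl , refl)) = separates-monochromatic sep e e∉Fs
  step (e , e∉Fs , inj₂ (refl , refl)) = sym (separates-monochromatic sep e e∉Fs)

p3-boundary-edgeCut : ∀ {a b c} → InducesP3 a b c → WEdgeCut 5 (boundary a b c)
p3-boundary-edgeCut {a} {b} {c} p3 =
  boundary-sorted a b c , p3-boundary-length p3 , separates⇒disconnects (boundary-separates a b c)

p3-separating-cut≡boundary : ∀ {Fs a b c} → InducesP3 a b c → Separates Fs a b c →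
                             Linked Fin._<_ Fs → length Fs ≡ 5 → Fs ≡ boundary a b c
p3-separating-cut≡boundary {Fs} {a} {b} {c} p3 sep Fs-sorted |Fs|≡5 =
  sym (Linked-⊆-length⇒≡ {_<_ = Fin._<_} Finₚ.<-trans Finₚ.<-cmp {boundary a b c} {Fs}
         (boundary-sorted a b c) Fs-sorted (boundary-⊆ sep)
         (trans (p3-boundary-length p3) (sym |Fs|≡5)))

module ChainColouring (x : Fin 12 → ℕ) (χ : Fin 8 → Bool) (A : List GE)
                      (valid : All (ValidE x) A)
                      (monochromatic : ∀ i → i ∉ map proj₁ A → χ (src i) ≡ χ (tgt i)) where

  _∈A? : ∀ e → Dec (e ∈ A)
  e ∈A? = any? (Productₚ.≡-dec Finₚ._≟_ ℕ._≟_ e) A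

  crossed : Fin 12 → ℕ → Bool
  crossed i zero    = false
  crossed i (suc p) = crossed i p ∨ does ((i , p) ∈A?)

  chainColour : Fin 12 → ℕ → Bool
  chainColour i p = if crossed i p then χ (tgt i) else χ (src i)

  colour : GV → Bool
  colour (inj₁ v)       = χ v
  colour (inj₂ (i , p)) = chainColour i p

  crossed-step : ∀ {i p} → (i , p) ∉ A → crossed i (suc p) ≡ crossed i p
  crossed-step {i} {p} ∉A =
    trans (cong (crossed i p ∨_) (dec-false ((i , p) ∈A?) ∉A)) (Boolₚ.∨-identityʳ _)

  crossed-after : ∀ {i k p} → (i , k) ∈ A → k ℕ.< p → crossed i p ≡ true
  crossed-after {i} {k} {suc p} ∈A k<1+p with ℕₚ.m<1+n⇒m<n∨m≡n k<1+p
  ... | inj₁ k<p  = cong (_∨ does ((i , p) ∈A?)) (crossed-after ∈A k<p)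
  ... | inj₂ refl = trans (cong (crossed i p ∨_) (dec-true ((i , p) ∈A?) ∈A)) (Boolₚ.∨-zeroʳ _)

  crossed-never : ∀ {i} → i ∉ map proj₁ A → ∀ p → crossed i p ≡ false
  crossed-never i∉ zero    = refl
  crossed-never i∉ (suc p) = trans (crossed-step (i∉ ∘ ∈-map⁺ proj₁)) (crossed-never i∉ p)

  chainColour-end : ∀ i → chainColour i (x i) ≡ χ (tgt i)
  chainColour-end i with any? (i Finₚ.≟_) (map proj₁ A)
  ... | yes i∈ with ∈-map⁻ proj₁ i∈
  ...   | (.i , k) , ∈A , refl =
    cong (if_then χ (tgt i) else χ (src i)) (crossed-after ∈A (All.lookup valid ∈A))
  chainColour-end i | no i∉ =
    trans (cong (if_then χ (tgt i) else χ (src i)) (crossed-never i∉ (x i))) (monochromatic i i∉)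

  colour-pos : ∀ i p → colour (pos x i p) ≡ chainColour i p
  colour-pos i zero    = refl
  colour-pos i (suc q) with suc q ℕ.≡ᵇ x i in at-end
  ... | false = refl
  ... | true  = sym (subst (λ p → chainColour i p ≡ χ (tgt i))
                           (sym (ℕₚ.≡ᵇ⇒≡ (suc q) (x i) (subst T (sym at-end) tt)))
                           (chainColour-end i))

  colour-along : ∀ {i k} → (i , k) ∉ A → colour (pos x i k) ≡ colour (pos x i (suc k))
  colour-along {i} {k} ∉A = begin
    colour (pos x i k)        ≡⟨ colour-pos i k ⟩
    chainColour i k           ≡⟨ cong (if_then χ (tgt i) else χ (src i)) (crossed-step ∉A) ⟨
    chainColour i (suc k)     ≡⟨ colour-pos i (suc k) ⟨
    colour (pos x i (suc k))  ∎
    where open ≡-Reasoning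

  colour-step : ∀ {u v} → GAdj x A u v → colour u ≡ colour v
  colour-step (_ , _ , ∉A , inj₁ (refl , refl)) = colour-along ∉A
  colour-step (_ , _ , ∉A , inj₂ (refl , refl)) = sym (colour-along ∉A)

  disconnects : ∀ {u w} → χ u ≡ true → χ w ≡ false → GDisconnects x A
  disconnects {u} {w} χu χw = inj₁ u , inj₁ w , tt , tt , λ path →
    contradiction (trans (sym χu) (trans (Star-invariant colour colour-step path) χw)) λ ()

chains-sorted : ∀ {A} → Linked _<ᴱ_ A → Linked Fin._≤_ (map proj₁ A)
chains-sorted = Linkedₚ.map⁺ ∘ Linked.map λ where
  (inj₁ i<j)        → ℕₚ.<⇒≤ i<j
  (inj₂ (refl , _)) → Finₚ.≤-refl

module _ (x : Fin 12 → ℕ) where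

  choices : List (Fin 12) → List (List GE)
  choices []       = [ [] ]
  choices (f ∷ fs) = cartesianProductWith (λ k A → (f , k) ∷ A) (upTo (x f)) (choices fs)

  ∈-choices⁺ : ∀ {fs} A → map proj₁ A ≡ fs → All (ValidE x) A → A ∈ choices fs
  ∈-choices⁺ []            refl []             = here refl
  ∈-choices⁺ ((f , k) ∷ A) refl (k<xf ∷ valid) =
    ∈-cartesianProductWith⁺ (λ k A → (f , k) ∷ A) (∈-upTo⁺ k<xf) (∈-choices⁺ A refl valid)

  ∈-choices⁻ : ∀ fs {A} → A ∈ choices fs → map proj₁ A ≡ fs × All (ValidE x) A
  ∈-choices⁻ []       (here refl) = refl , []
  ∈-choices⁻ (f ∷ fs) A∈
    with ∈-cartesianProductWith⁻ (λ k A → (f , k) ∷ A) (upTo (x f)) (choices fs) A∈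
  ... | k , A , k∈ , A∈ , refl with ∈-choices⁻ fs A∈
  ...   | refl , valid = refl , ∈-upTo⁻ k∈ ∷ valid

  choices-unique : ∀ fs → Unique (choices fs)
  choices-unique []       = [] ∷ []
  choices-unique (f ∷ fs) = Uniqueₚ.cartesianProductWith⁺ _ (λ { refl → refl , refl })
                              (Uniqueₚ.upTo⁺ (x f)) (choices-unique fs)

  length-choices : ∀ fs → length (choices fs) ≡ productOf ℕ.+-*-rawSemiring x fs
  length-choices []       = refl
  length-choices (f ∷ fs) = begin
    length (choices (f ∷ fs))
      ≡⟨ length-cartesianProductWith _ (upTo (x f)) (choices fs) ⟩
    length (upTo (x f)) ℕ.* length (choices fs)
      ≡⟨ cong₂ ℕ._*_ (Listₚ.length-upTo (x f)) (length-choices fs) ⟩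
    x f ℕ.* productOf ℕ.+-*-rawSemiring x fs
      ∎
    where open ≡-Reasoning

  one-per-chain⇒InducedP3Cut : ∀ {A a b c} → InducesP3 a b c →
    map proj₁ A ≡ boundary a b c → All (ValidE x) A → InducedP3Cut x A
  one-per-chain⇒InducedP3Cut {A} {a} {b} {c} p3 A↦B valid =
    ( ( Linked.map inj₁ (Linkedₚ.map⁻ (subst (Linked Fin._<_) (sym A↦B) (boundary-sorted a b c)))
      , valid
      , trans (sym (Listₚ.length-map proj₁ A)) (trans (cong length A↦B) (p3-boundary-length p3))
      , ChainColouring.disconnects x (inS a b c) A valid (separates-monochromatic sep)
          {a} {proj₁ (outside a b c)} (inS-self a b c) (proj₂ (outside a b c)) )
    , boundary a b c , p3-boundary-edgeCut p3 , (a , b , c , p3 , boundary-separates a b c)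
    , ↭-reflexive A↦B )
    where
    sep : Separates (map proj₁ A) a b c
    sep = subst (λ Fs → Separates Fs a b c) (sym A↦B) (boundary-separates a b c)

  InducedP3Cut⇒one-per-chain : ∀ {A} → InducedP3Cut x A →
    Σ[ (a , b , c) ∈ Triple ] (InducesP3 a b c × map proj₁ A ≡ boundary a b c)
  InducedP3Cut⇒one-per-chain {A}
    ((A-sorted , _ , _ , _) , Fs , (Fs-sorted , |Fs|≡5 , _) , (a , b , c , p3 , sep) , A↭Fs) =
    (a , b , c) , p3 ,
    Pointwise-≡⇒≡ (↗↭↗⇒≋ (Finₚ.≤-totalOrder 12) (chains-sorted A-sorted)
                    (Linked.map ℕₚ.<⇒≤ (boundary-sorted a b c))
                    (↭⇒↭ₛ (subst (map proj₁ A ↭_) Fs≡B A↭Fs)))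
    where
    Fs≡B : Fs ≡ boundary a b c
    Fs≡B = p3-separating-cut≡boundary p3 sep Fs-sorted |Fs|≡5

  inducedCuts : List (List GE)
  inducedCuts = concatMap choices p3Cuts

  inducedCuts-sound : ∀ {A} → A ∈ inducedCuts → InducedP3Cut x A
  inducedCuts-sound A∈ =
    let B , B∈ , A∈B          = find (∈-concatMap⁻ choices {xs = p3Cuts} A∈)
        (a , b , c) , p3 , B≡ = ∈-p3Cuts⁻ B∈
        A↦B , valid           = ∈-choices⁻ B A∈B
    in one-per-chain⇒InducedP3Cut {a = a} {b} {c} p3 (trans A↦B B≡) valid

  inducedCuts-complete : ∀ {A} → InducedP3Cut x A → A ∈ inducedCuts
  inducedCuts-complete {A} induced@((_ , valid , _) , _) =
    let (a , b , c) , p3 , A↦B = InducedP3Cut⇒one-per-chain induced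
    in ∈-concatMap⁺ choices (lose (∈-p3Cuts⁺ {a} {b} {c} p3) (∈-choices⁺ A A↦B valid))

  inducedCuts-unique : Unique inducedCuts
  inducedCuts-unique = concatMap-unique p3Cuts-unique
    where
    concatMap-unique : ∀ {Bs} → Unique Bs → Unique (concatMap choices Bs)
    concatMap-unique {[]}     []           = []
    concatMap-unique {B ∷ Bs} (B∉Bs ∷ Bs!) =
      Uniqueₚ.++⁺ (choices-unique B) (concatMap-unique Bs!) disjoint
      where
      disjoint : ∀ {A} → ¬ (A ∈ choices B × A ∈ concatMap choices Bs)
      disjoint (A∈B , A∈Bs) =
        let B′ , B′∈Bs , A∈B′ = find (∈-concatMap⁻ choices {xs = Bs} A∈Bs) in
        All.lookup B∉Bs B′∈Bs (trans (sym (proj₁ (∈-choices⁻ B A∈B))) (proj₁ (∈-choices⁻ B′ A∈B′)))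

  length-inducedCuts : length inducedCuts ≡ sumOfProducts ℕ.+-*-rawSemiring x p3Cuts
  length-inducedCuts = length-concatMap p3Cuts
    where
    length-concatMap : ∀ Bs → length (concatMap choices Bs) ≡ sumOfProducts ℕ.+-*-rawSemiring x Bs
    length-concatMap []       = refl
    length-concatMap (B ∷ Bs) =
      trans (Listₚ.length-++ (choices B)) (cong₂ ℕ._+_ (length-choices B) (length-concatMap Bs))

  μ5P3-sumOfProducts : μ5P3 x (sumOfProducts ℕ.+-*-rawSemiring x p3Cuts)
  μ5P3-sumOfProducts =
    inducedCuts , inducedCuts-unique , (λ A → inducedCuts-sound , inducedCuts-complete) ,
    length-inducedCuts

module _ (R : RawRing 0ℓ 0ℓ) where
  open RawRing R

  private
    infixl 6 _-_
    _-_ : Carrier → Carrier → Carrier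
    a - b = a + - b

  transfer : ∀ {n} → Fin n → Fin n → (Fin n → Carrier) → Fin n → Carrier
  transfer i j x m =
    if does (m Finₚ.≟ i) then 1# + x m
    else if does (m Finₚ.≟ j) then x m - 1#
    else x m

  p3TransferLoss : (Fin 12 → Carrier) → Carrier
  p3TransferLoss x =
    sumOfProducts rawSemiring x p3Cuts - sumOfProducts rawSemiring (transfer (# 0) (# 4) x) p3Cuts

  p3Difference : (ℕ → Carrier) → Carrier
  p3Difference L =
    (L 1 + 1# - L 5) * (L 2 * L 4 * L 6 + L 6 * L 10 * L 12 + L 7 * L 10 * L 11)
    + L 2 * L 3 * L 4 * L 10 + L 3 * L 6 * L 7 * L 11 + L 2 * L 6 * L 7 * L 9
    + L 4 * L 7 * L 8 * L 9 + L 3 * L 6 * L 8 * L 10 + L 2 * L 9 * L 11 * L 12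
    + L 4 * L 9 * L 10 * L 11
    - L 2 * L 3 * L 7 * L 8 - L 2 * L 4 * L 9 * L 12 - L 3 * L 4 * L 6 * L 7
    - L 2 * L 3 * L 10 * L 11 - L 3 * L 4 * L 11 * L 12 - L 6 * L 8 * L 9 * L 12
    - L 7 * L 8 * L 9 * L 11

open import Data.Integer using (ℤ; +_; _+_; _-_; _*_)
import Data.Integer.Base as ℤ
import Data.Integer.Properties as ℤₚ
open import Data.Integer.Solver using (module +-*-Solver)
open +-*-Solver using (Polynomial; con; var; _:+_; _:*_; :-_; prove)

polynomialRing : RawRing 0ℓ 0ℓ
polynomialRing = record
  { Carrier = Polynomial 12
  ; _≈_     = _≡_
  ; _+_     = _:+_
  ; _*_     = _:*_
  ; -_      = :-_
  ; 0#      = con (+ 0)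
  ; 1#      = con (+ 1)
  }

-- Both sides are built generically over a raw ring, so instantiating them at polynomialRing
-- yields their syntax for the ring solver.
p3TransferLoss≡p3Difference : ∀ (L : ℕ → ℤ) →
  p3TransferLoss ℤ.+-*-rawRing (L ∘ suc ∘ toℕ) ≡ p3Difference ℤ.+-*-rawRing L
p3TransferLoss≡p3Difference L =
  prove (tabulate (L ∘ suc ∘ toℕ)) (p3TransferLoss polynomialRing var)
        (p3Difference polynomialRing (var ∘ chain)) refl
  where
  -- e_k is chain k ∸ 1; mod 12 only makes this total, as k ranges over 1, …, 12.
  chain : ℕ → Fin 12
  chain k = (k ∸ 1) mod 12

pos-sumOfProducts : ∀ {I : Set} (x : I → ℕ) Bs →
  + sumOfProducts ℕ.+-*-rawSemiring x Bs ≡ sumOfProducts ℤ.+-*-rawSemiring (+_ ∘ x) Bs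
pos-sumOfProducts x []       = refl
pos-sumOfProducts x (B ∷ Bs) =
  trans (ℤₚ.pos-+ (productOf ℕ.+-*-rawSemiring x B) _)
        (cong₂ _+_ (pos-productOf B) (pos-sumOfProducts x Bs))
  where
  pos-productOf : ∀ B → + productOf ℕ.+-*-rawSemiring x B ≡ productOf ℤ.+-*-rawSemiring (+_ ∘ x) B
  pos-productOf []      = refl
  pos-productOf (i ∷ B) = trans (ℤₚ.pos-* (x i) _) (cong (+ x i *_) (pos-productOf B))

1≤ℓ : ∀ {n} → 13 ≤ n → ∀ k → 1 ≤ ℓ n k
1≤ℓ {n} 13≤n k = ℕₚ.≤-trans 1≤s s≤ℓ
  where
  1≤s : 1 ≤ sOf n
  1≤s = m≥n⇒m/n>0 (ℕₚ.m≤n⇒m≤n+o 4 (ℕₚ.≤-trans (ℕₚ.n≤1+n 12) 13≤n))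
  s≤ℓ : sOf n ≤ ℓ n k
  s≤ℓ with inX (rOf n) k
  ... | true  = ℕₚ.n≤1+n (sOf n)
  ... | false = ℕₚ.≤-refl

lenH≗transfer : ∀ n → 1 ≤ ℓ n 5 → +_ ∘ lenH n ≗ transfer ℤ.+-*-rawRing (# 0) (# 4) (+_ ∘ lenG n)
lenH≗transfer n _    zero                              = refl
lenH≗transfer n _    (suc zero)                        = refl
lenH≗transfer n _    (suc (suc zero))                  = refl
lenH≗transfer n _    (suc (suc (suc zero)))            = refl
lenH≗transfer n 1≤ℓ₅ (suc (suc (suc (suc zero))))      = sym (ℤₚ.⊖-≥ 1≤ℓ₅)
lenH≗transfer n _    (suc (suc (suc (suc (suc _))))) = refl

lemma14 : (n : ℕ) → 13 ≤ n → n ≢ 16 →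
  let L : ℕ → ℤ
      L k = + ℓ n k
  in (Σ[ a ∈ ℕ ] μ5P3 (lenG n) a) × (Σ[ b ∈ ℕ ] μ5P3 (lenH n) b) ×
     ((a b : ℕ) → μ5P3 (lenG n) a → μ5P3 (lenH n) b →
      (+ a) - (+ b) ≡
        (L 1 + + 1 - L 5) * (L 2 * L 4 * L 6 + L 6 * L 10 * L 12 + L 7 * L 10 * L 11)
        + L 2 * L 3 * L 4 * L 10 + L 3 * L 6 * L 7 * L 11 + L 2 * L 6 * L 7 * L 9
        + L 4 * L 7 * L 8 * L 9 + L 3 * L 6 * L 8 * L 10 + L 2 * L 9 * L 11 * L 12
        + L 4 * L 9 * L 10 * L 11
        - L 2 * L 3 * L 7 * L 8 - L 2 * L 4 * L 9 * L 12 - L 3 * L 4 * L 6 * L 7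
        - L 2 * L 3 * L 10 * L 11 - L 3 * L 4 * L 11 * L 12 - L 6 * L 8 * L 9 * L 12
        - L 7 * L 8 * L 9 * L 11)
lemma14 n 13≤n _ =
  (_ , μ5P3-sumOfProducts (lenG n)) , (_ , μ5P3-sumOfProducts (lenH n)) , difference
  where
  μ : (Fin 12 → ℕ) → ℕ
  μ x = sumOfProducts ℕ.+-*-rawSemiring x p3Cuts

  H≗transfer : +_ ∘ lenH n ≗ transfer ℤ.+-*-rawRing (# 0) (# 4) (+_ ∘ lenG n)
  H≗transfer = lenH≗transfer n (1≤ℓ 13≤n 5)

  difference : ∀ a b → μ5P3 (lenG n) a → μ5P3 (lenH n) b →
               + a - + b ≡ p3Difference ℤ.+-*-rawRing (λ k → + ℓ n k)
  difference a b μG μH = begin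
    + a - + b
      ≡⟨ cong₂ (λ a b → + a - + b) (CountIs-unique μG (μ5P3-sumOfProducts (lenG n)))
                                   (CountIs-unique μH (μ5P3-sumOfProducts (lenH n))) ⟩
    + μ (lenG n) - + μ (lenH n)
      ≡⟨ cong₂ _-_ (pos-sumOfProducts (lenG n) p3Cuts)
                   (trans (pos-sumOfProducts (lenH n) p3Cuts)
                          (sumOfProducts-cong ℤ.+-*-rawSemiring H≗transfer p3Cuts)) ⟩
    p3TransferLoss ℤ.+-*-rawRing (+_ ∘ lenG n)
      ≡⟨ p3TransferLoss≡p3Difference (λ k → + ℓ n k) ⟩
    p3Difference ℤ.+-*-rawRing (λ k → + ℓ n k)
      ∎
    where open ≡-Reasoning
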